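{- $f_3(n,5,3)= e^{O(\sqrt{\log\log n})}$; that is, there exist constants $C>0$ and $n_0$ such that for all $n\ge n_0$ there is an edge-coloring of the complete $3$-uniform hypergraph $K_n^3$ with at most $e^{C\sqrt{\log\log n}}$ colors in which, for every set of five vertices, the ten edges (triples) spanned by those five vertices receive at least three distinct colors.
   Context: $K_n^3$ denotes the complete $3$-uniform hypergraph on $n$ vertices (all $3$-element subsets of an $n$-element vertex set). A $(p,q)$-coloring of $K_n^k$ is an edge-coloring of $K_n^k$ in which every copy of $K_p^k$ (i.e. the set of all $k$-subsets of any $p$ vertices) receives at least $q$ distinct colors. $f_k(n,p,q)$ denotes the minimum number of colors in a $(p,q)$-coloring of $K_n^k$. -}

module Defs where

open import Data.Nat using (ℕ; _≤_; _^_; _*_)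
open import Data.Fin using (Fin; _<_)
open import Data.List using (List; []; _∷_)
open import Data.List.Membership.Propositional using (_∈_)
open import Data.Product using (Σ; ∃; _×_)
open import Relation.Binary.PropositionalEquality using (_≢_)

-- An edge-colouring of K_n^3 with colours in Fin k.  A 3-edge {a,b,c} with
-- a < b < c is coloured  col a b c ; values of col on non-increasing triples
-- are irrelevant (never inspected).
Coloring3 : ℕ → ℕ → Set
Coloring3 n k = Fin n → Fin n → Fin n → Fin k

AtLeast3Distinct : {A : Set} → List A → Set
AtLeast3Distinct {A} xs =
  Σ A λ x → Σ A λ y → Σ A λ z →
    (x ∈ xs) × (y ∈ xs) × (z ∈ xs) × (x ≢ y) × (y ≢ z) × (x ≢ z)

tenColors : ∀ {n k} → Coloring3 n k → (v0 v1 v2 v3 v4 : Fin n) → List (Fin k)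
tenColors c v0 v1 v2 v3 v4 =
  c v0 v1 v2 ∷ c v0 v1 v3 ∷ c v0 v1 v4 ∷ c v0 v2 v3 ∷ c v0 v2 v4 ∷
  c v0 v3 v4 ∷ c v1 v2 v3 ∷ c v1 v2 v4 ∷ c v1 v3 v4 ∷ c v2 v3 v4 ∷ []

Is53Coloring : ∀ {n k} → Coloring3 n k → Set
Is53Coloring {n} c = (v0 v1 v2 v3 v4 : Fin n) →
  v0 < v1 → v1 < v2 → v2 < v3 → v3 < v4 →
  AtLeast3Distinct (tenColors c v0 v1 v2 v3 v4)

{-# OPTIONS --safe #-}
-- Identify the vertices with binary words of length M = 2 ^ (s * s) and, for a < b, let
-- δ(a, b) be the first position where their words differ.  Along a < b < c the values
-- δ(a, b) and δ(b, c) are distinct and δ(a, c) is their minimum.  The triple a < b < c gets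
-- the colour of the pair (δ(a, b), δ(b, c)): whether the pair increases, together with
-- Mubayi's colour of the pair written as s digits in base 2 ^ s (where the digits agree,
-- and the first digits where they differ), 2 ^ (3s + 1) colours in all.  For v₀ < ⋯ < v₄
-- with consecutive values d₁, d₂, d₃, d₄ of δ, consecutive pairs get different colours;
-- if (d₁, d₂) and (d₃, d₄) get the same colour, the triple v₀ v₂ v₄ has pair (d₁, d₃) or
-- (d₂, d₄), and the first digit at which d₁ and d₂ differ tells its colour apart from
-- those of (d₁, d₂) and (d₂, d₃).
module Submission where

open import Defs
open import Data.Nat using (ℕ; _≤_; _^_; _*_; _<_)
open import Data.Product using (Σ; _×_)

open import Data.Bool using (Bool; true; false)
import Data.Bool.Properties as Bool
open import Data.Fin as Fin using (Fin; toℕ; combine; #_)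
import Data.Fin.Properties as Fin
open import Data.List using (List)
open import Data.List.Membership.Propositional using (_∈_)
open import Data.List.Membership.Propositional.Properties using (∈-lookup)
open import Data.Nat using (zero; suc; _+_; _∸_; _⊓_; _<ᵇ_; _≤?_; z≤n; s≤s; z<s; s<s)
open import Data.Nat.Properties
  using (<ᵇ-reflects-<; suc-injective; ≤-trans; <⇒≤; ≰⇒>; ≮⇒≥; <-≤-trans; <-cmp; n≮n; ∸-monoˡ-<; m+n∸m≡n; +-identityʳ;
         +-monoˡ-≤; ^-monoʳ-≤; m≤n⇒m⊓n≡m; m≥n⇒m⊓n≡n; module ≤-Reasoning)
open import Data.Product as Product using (∃; _,_; proj₁; proj₂)
open import Data.Sum as Sum using (_⊎_; inj₁; inj₂; [_,_])
open import Data.Vec using (Vec; []; _∷_; _++_; concat; group; lookup; zipWith; replicate)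
import Data.Vec.Properties as Vec
open import Function using (_∘_)
open import Function.Bundles using (_↣_; mk↣; Injection)
open import Function.Construct.Composition using (_↣-∘_)
open import Function.Definitions using (Injective)
open import Function.Consequences.Propositional using (contraInjective)
open import Function.Properties.Inverse using (↔-sym; ↔⇒↣)
open import Relation.Binary.Definitions using (DecidableEquality; tri<; tri≈; tri>)
open import Relation.Binary.PropositionalEquality
  using (_≡_; _≢_; refl; sym; trans; cong; cong₂; module ≡-Reasoning)
open import Relation.Nullary using (yes; no; does; contradiction)
open import Relation.Nullary.Reflects using (ofʸ; ofⁿ)
open import Relation.Nullary.Decidable using (dec-true; dec-false)

module _ {A B : Set} (ι : A ↣ B) (_≟_ : DecidableEquality B) where
  open Injection ι using (to; injective)

  private
    to-≢ : ∀ {x y} → x ≢ y → to x ≢ to y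
    to-≢ = contraInjective injective

  atLeast3Distinct-of-four : ∀ {xs : List B} {a b c d : A} →
    to a ∈ xs → to b ∈ xs → to c ∈ xs → to d ∈ xs →
    a ≢ b → b ≢ c → (a ≡ c → a ≢ d × b ≢ d) → AtLeast3Distinct xs
  atLeast3Distinct-of-four {a = a} {b} {c} {d} a∈ b∈ c∈ d∈ a≢b b≢c a≡c⇒ with to a ≟ to c
  ... | no ta≢tc = to a , to b , to c , a∈ , b∈ , c∈ , to-≢ a≢b , to-≢ b≢c , ta≢tc
  ... | yes ta≡tc with a≢d , b≢d ← a≡c⇒ (injective ta≡tc) =
    to a , to b , to d , a∈ , b∈ , d∈ , to-≢ a≢b , to-≢ b≢d , to-≢ a≢d

module _ {A : Set} {m : ℕ} (ι : A ↣ Fin m) where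
  open Injection ι using (to; injective)

  encode : ∀ {L} → Vec A L → Fin (m ^ L)
  encode []       = Fin.zero
  encode (x ∷ xs) = combine (to x) (encode xs)

  encode-injective : ∀ {L} → Injective _≡_ _≡_ (encode {L})
  encode-injective {x = []}     {[]}     _  = refl
  encode-injective {x = x ∷ xs} {y ∷ ys} eq
    with x≡y , xs≡ys ← Fin.combine-injective (to x) (encode xs) (to y) (encode ys) eq =
    cong₂ _∷_ (injective x≡y) (encode-injective xs≡ys)

  vec↣ : ∀ {L} → Vec A L ↣ Fin (m ^ L)
  vec↣ = mk↣ encode-injective

bit↣ : Bool ↣ Fin 2
bit↣ = ↔⇒↣ (↔-sym Fin.2↔Bool)

infix 4 _≺_

data _≺_ : ∀ {M} → Vec Bool M → Vec Bool M → Set where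
  this : ∀ {M} {u v : Vec Bool M} → false ∷ u ≺ true ∷ v
  next : ∀ {M x} {u v : Vec Bool M} → u ≺ v → x ∷ u ≺ x ∷ v

≺⇒≢ : ∀ {M} {u v : Vec Bool M} → u ≺ v → u ≢ v
≺⇒≢ this       ()
≺⇒≢ (next u≺v) = ≺⇒≢ u≺v ∘ Vec.∷-injectiveʳ

-- Big-endian binary expansion; only meaningful for a < 2 ^ M.
toBits : (M : ℕ) → ℕ → Vec Bool M
toBits zero    a = []
toBits (suc M) a with 2 ^ M ≤? a
... | yes _ = true  ∷ toBits M (a ∸ 2 ^ M)
... | no  _ = false ∷ toBits M a

toBits-strictMono : ∀ M {a b} → a < b → b < 2 ^ M → toBits M a ≺ toBits M b
toBits-strictMono zero    {b = zero}  ()  _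
toBits-strictMono zero    {b = suc _} _   (s≤s ())
toBits-strictMono (suc M) {a} {b} a<b b<2^[1+M] with 2 ^ M ≤? a | 2 ^ M ≤? b
... | yes 2^M≤a | yes 2^M≤b = next (toBits-strictMono M (∸-monoˡ-< a<b 2^M≤a) b∸2^M<2^M)
  where
    open ≤-Reasoning
    b∸2^M<2^M : b ∸ 2 ^ M < 2 ^ M
    b∸2^M<2^M = begin-strict
      b ∸ 2 ^ M               <⟨ ∸-monoˡ-< b<2^[1+M] 2^M≤b ⟩
      2 ^ suc M ∸ 2 ^ M       ≡⟨ cong (λ k → 2 ^ M + k ∸ 2 ^ M) (+-identityʳ (2 ^ M)) ⟩
      2 ^ M + 2 ^ M ∸ 2 ^ M   ≡⟨ m+n∸m≡n (2 ^ M) (2 ^ M) ⟩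
      2 ^ M                   ∎
... | yes 2^M≤a | no 2^M≰b = contradiction (≤-trans 2^M≤a (<⇒≤ a<b)) 2^M≰b
... | no _      | yes _    = this
... | no _      | no 2^M≰b = next (toBits-strictMono M a<b (≰⇒> 2^M≰b))

toBits-injective : ∀ M {a b} → a < 2 ^ M → b < 2 ^ M → toBits M a ≡ toBits M b → a ≡ b
toBits-injective M {a} {b} a<2^M b<2^M eq with <-cmp a b
... | tri< a<b _ _ = contradiction eq (≺⇒≢ (toBits-strictMono M a<b b<2^M))
... | tri≈ _ a≡b _ = a≡b
... | tri> _ _ b<a = contradiction (sym eq) (≺⇒≢ (toBits-strictMono M b<a a<2^M))

firstDiff : ∀ {M} → Vec Bool M → Vec Bool M → ℕ
firstDiff []          []          = 0
firstDiff (false ∷ u) (false ∷ v) = suc (firstDiff u v)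
firstDiff (true  ∷ u) (true  ∷ v) = suc (firstDiff u v)
firstDiff (false ∷ _) (true  ∷ _) = 0
firstDiff (true  ∷ _) (false ∷ _) = 0

firstDiff-< : ∀ {M} {u v : Vec Bool M} → u ≺ v → firstDiff u v < M
firstDiff-< this                 = z<s
firstDiff-< (next {x = false} l) = s<s (firstDiff-< l)
firstDiff-< (next {x = true}  l) = s<s (firstDiff-< l)

firstDiff-≢ : ∀ {M} {u v w : Vec Bool M} → u ≺ v → v ≺ w → firstDiff u v ≢ firstDiff v w
firstDiff-≢ this                 (next _)  ()
firstDiff-≢ (next {x = false} _) this      ()
firstDiff-≢ (next {x = false} l) (next l′) = firstDiff-≢ l l′ ∘ suc-injective
firstDiff-≢ (next {x = true}  l) (next l′) = firstDiff-≢ l l′ ∘ suc-injective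

firstDiff-⊓ : ∀ {M} {u v w : Vec Bool M} → u ≺ v → v ≺ w →
  firstDiff u w ≡ firstDiff u v ⊓ firstDiff v w
firstDiff-⊓ this                 (next _)  = refl
firstDiff-⊓ (next {x = false} _) this      = refl
firstDiff-⊓ (next {x = false} l) (next l′) = cong suc (firstDiff-⊓ l l′)
firstDiff-⊓ (next {x = true}  l) (next l′) = cong suc (firstDiff-⊓ l l′)

module Mubayi {A : Set} (_≟_ : DecidableEquality A) (default : A) where

  equalityPattern : ∀ {t} → Vec A t → Vec A t → Vec Bool t
  equalityPattern = zipWith λ a b → does (a ≟ b)

  -- Only ever applied to distinct vectors; the default is a junk value for equal ones.
  firstDisagreement : ∀ {t} → Vec A t → Vec A t → A × A
  firstDisagreement []      []      = default , default
  firstDisagreement (a ∷ X) (b ∷ Y) with a ≟ b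
  ... | yes _ = firstDisagreement X Y
  ... | no  _ = a , b

  mubayi : ∀ {t} → Vec A t → Vec A t → Vec Bool t × (A × A)
  mubayi X Y = equalityPattern X Y , firstDisagreement X Y

  separatingPosition : ∀ {t} (X₁ X₂ X₃ X₄ : Vec A t) → X₁ ≢ X₂ → mubayi X₁ X₂ ≡ mubayi X₃ X₄ →
    ∃ λ i → lookup X₁ i ≡ lookup X₃ i × lookup X₂ i ≡ lookup X₄ i × lookup X₁ i ≢ lookup X₂ i
  separatingPosition [] [] [] [] X₁≢X₂ _ = contradiction refl X₁≢X₂
  separatingPosition (a₁ ∷ X₁) (a₂ ∷ X₂) (a₃ ∷ X₃) (a₄ ∷ X₄) ne eq with a₁ ≟ a₂ | a₃ ≟ a₄
  ... | yes refl | yes refl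
      with i , rest ← separatingPosition X₁ X₂ X₃ X₄ (ne ∘ cong (a₁ ∷_))
                        (cong₂ _,_ (Vec.∷-injectiveʳ (cong proj₁ eq)) (cong proj₂ eq))
      = Fin.suc i , rest
  ... | no a₁≢a₂ | no _ = Fin.zero , cong (proj₁ ∘ proj₂) eq , cong (proj₂ ∘ proj₂) eq , a₁≢a₂
  ... | yes _    | no _ with () ← Vec.∷-injectiveˡ (cong proj₁ eq)
  ... | no _     | yes _ with () ← Vec.∷-injectiveˡ (cong proj₁ eq)

  mubayi-≢-at : ∀ {t} {X Y X′ Y′ : Vec A t} (i : Fin t) →
    lookup X i ≡ lookup Y i → lookup X′ i ≢ lookup Y′ i → mubayi X Y ≢ mubayi X′ Y′
  mubayi-≢-at {X = X} {Y} {X′} {Y′} i Xᵢ≡Yᵢ X′ᵢ≢Y′ᵢ same = true≢false (begin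
    true                               ≡⟨ dec-true (lookup X i ≟ lookup Y i) Xᵢ≡Yᵢ ⟨
    does (lookup X i ≟ lookup Y i)     ≡⟨ Vec.lookup-zipWith _ i X Y ⟨
    lookup (equalityPattern X Y) i     ≡⟨ cong (λ c → lookup (proj₁ c) i) same ⟩
    lookup (equalityPattern X′ Y′) i   ≡⟨ Vec.lookup-zipWith _ i X′ Y′ ⟩
    does (lookup X′ i ≟ lookup Y′ i)   ≡⟨ dec-false (lookup X′ i ≟ lookup Y′ i) X′ᵢ≢Y′ᵢ ⟩
    false                              ∎)
    where
      open ≡-Reasoning
      true≢false : true ≢ false
      true≢false ()

  mubayi-consecutive : ∀ {t} {X Y Z : Vec A t} → X ≢ Y → mubayi X Y ≢ mubayi Y Z
  mubayi-consecutive {X = X} {Y} {Z} X≢Y eq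
    with _ , Xᵢ≡Yᵢ , _ , Xᵢ≢Yᵢ ← separatingPosition X Y Y Z X≢Y eq = Xᵢ≢Yᵢ Xᵢ≡Yᵢ

  mubayi-square : ∀ {t} {X₁ X₂ X₃ X₄ Y Z : Vec A t} → X₁ ≢ X₂ → mubayi X₁ X₂ ≡ mubayi X₃ X₄ →
    (Y ≡ X₁ × Z ≡ X₃) ⊎ (Y ≡ X₂ × Z ≡ X₄) →
    mubayi Y Z ≢ mubayi X₁ X₂ × mubayi Y Z ≢ mubayi X₂ X₃
  mubayi-square {X₁ = X₁} {X₂} {X₃} {X₄} {Y} {Z} X₁≢X₂ eq diagonal =
    let i , e₁₃ , e₂₄ , n₁₂ = separatingPosition X₁ X₂ X₃ X₄ X₁≢X₂ eq
        Yᵢ≡Zᵢ : lookup Y i ≡ lookup Z i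
        Yᵢ≡Zᵢ = [ (λ { (refl , refl) → e₁₃ }) , (λ { (refl , refl) → e₂₄ }) ] diagonal
    in mubayi-≢-at i Yᵢ≡Zᵢ n₁₂ , mubayi-≢-at i Yᵢ≡Zᵢ (λ e₂₃ → n₁₂ (trans e₁₃ (sym e₂₃)))

⊓-sameOrder : ∀ {x y z w} → (x <ᵇ y) ≡ (z <ᵇ w) →
  (x ⊓ y ≡ x × z ⊓ w ≡ z) ⊎ (x ⊓ y ≡ y × z ⊓ w ≡ w)
⊓-sameOrder {x} {y} {z} {w} same
  with x <ᵇ y | <ᵇ-reflects-< x y | z <ᵇ w | <ᵇ-reflects-< z w | same
... | true  | ofʸ x<y | true  | ofʸ z<w | _ = inj₁ (m≤n⇒m⊓n≡m (<⇒≤ x<y) , m≤n⇒m⊓n≡m (<⇒≤ z<w))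
... | false | ofⁿ x≮y | false | ofⁿ z≮w | _ = inj₂ (m≥n⇒m⊓n≡n (≮⇒≥ x≮y) , m≥n⇒m⊓n≡n (≮⇒≥ z≮w))
... | true  | _       | false | _       | ()
... | false | _       | true  | _       | ()

module PairColouring (s : ℕ) where
  open Mubayi (Vec.≡-dec Bool._≟_) (replicate s false)

  digits : ℕ → Vec (Vec Bool s) s
  digits x = proj₁ (group s s (toBits (s * s) x))

  digits-injective : ∀ {x y} → x < 2 ^ (s * s) → y < 2 ^ (s * s) → digits x ≡ digits y → x ≡ y
  digits-injective {x} {y} x< y< eq = toBits-injective (s * s) x< y< (begin
    toBits (s * s) x   ≡⟨ proj₂ (group s s (toBits (s * s) x)) ⟩
    concat (digits x)  ≡⟨ cong concat eq ⟩
    concat (digits y)  ≡⟨ proj₂ (group s s (toBits (s * s) y)) ⟨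
    toBits (s * s) y   ∎)
    where open ≡-Reasoning

  PairColour : Set
  PairColour = Bool × Vec Bool s × (Vec Bool s × Vec Bool s)

  pairColour : ℕ → ℕ → PairColour
  pairColour x y = (x <ᵇ y) , mubayi (digits x) (digits y)

  pairColour-consecutive : ∀ {x y z} → x < 2 ^ (s * s) → y < 2 ^ (s * s) → x ≢ y →
    pairColour x y ≢ pairColour y z
  pairColour-consecutive x< y< x≢y =
    mubayi-consecutive (x≢y ∘ digits-injective x< y<) ∘ cong proj₂

  pairColour-square : ∀ {d₁ d₂ d₃ d₄} → d₁ < 2 ^ (s * s) → d₂ < 2 ^ (s * s) → d₁ ≢ d₂ →
    pairColour d₁ d₂ ≡ pairColour d₃ d₄ →
    pairColour d₁ d₂ ≢ pairColour (d₁ ⊓ d₂) (d₃ ⊓ d₄) ×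
    pairColour d₂ d₃ ≢ pairColour (d₁ ⊓ d₂) (d₃ ⊓ d₄)
  pairColour-square {d₁} {d₂} {d₃} {d₄} d₁< d₂< d₁≢d₂ eq =
    let n₁ , n₂ = mubayi-square (d₁≢d₂ ∘ digits-injective d₁< d₂<) (cong proj₂ eq) diagonal
    in n₁ ∘ sym ∘ cong proj₂ , n₂ ∘ sym ∘ cong proj₂
    where
      diagonal : (digits (d₁ ⊓ d₂) ≡ digits d₁ × digits (d₃ ⊓ d₄) ≡ digits d₃)
               ⊎ (digits (d₁ ⊓ d₂) ≡ digits d₂ × digits (d₃ ⊓ d₄) ≡ digits d₄)
      diagonal = Sum.map (Product.map (cong digits) (cong digits))
                         (Product.map (cong digits) (cong digits))
                         (⊓-sameOrder (cong proj₁ eq))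

  bitString : PairColour → Vec Bool (suc (s + (s + s)))
  bitString (b , e , p , q) = b ∷ e ++ p ++ q

  bitString-injective : Injective _≡_ _≡_ bitString
  bitString-injective {b , e , p , q} {b′ , e′ , p′ , q′} eq
    with refl , eq₁ ← Vec.∷-injective eq
    with refl , eq₂ ← Vec.++-injective e e′ eq₁
    with refl , refl ← Vec.++-injective p p′ eq₂ = refl

  pairColour↣ : PairColour ↣ Fin (2 ^ suc (s + (s + s)))
  pairColour↣ = vec↣ bit↣ ↣-∘ mk↣ bitString-injective

module TripleColouring (s n : ℕ) (n≤2^2^[s*s] : n ≤ 2 ^ 2 ^ (s * s)) where
  open PairColouring s

  word : Fin n → Vec Bool (2 ^ (s * s))
  word a = toBits (2 ^ (s * s)) (toℕ a)

  word-strictMono : ∀ {a b} → a Fin.< b → word a ≺ word b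
  word-strictMono {b = b} a<b = toBits-strictMono _ a<b (<-≤-trans (Fin.toℕ<n b) n≤2^2^[s*s])

  δ : Fin n → Fin n → ℕ
  δ a b = firstDiff (word a) (word b)

  tripleColour : Fin n → Fin n → Fin n → PairColour
  tripleColour a b c = pairColour (δ a b) (δ b c)

  colouring : Coloring3 n (2 ^ suc (s + (s + s)))
  colouring a b c = Injection.to pairColour↣ (tripleColour a b c)

  tripleColour-consecutive : ∀ {a b c d} → a Fin.< b → b Fin.< c → c Fin.< d →
    tripleColour a b c ≢ tripleColour b c d
  tripleColour-consecutive a<b b<c c<d = pairColour-consecutive
    (firstDiff-< (word-strictMono a<b)) (firstDiff-< (word-strictMono b<c))
    (firstDiff-≢ (word-strictMono a<b) (word-strictMono b<c))

  tripleColour-skip : ∀ {v₀ v₁ v₂ v₃ v₄} →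
    v₀ Fin.< v₁ → v₁ Fin.< v₂ → v₂ Fin.< v₃ → v₃ Fin.< v₄ →
    tripleColour v₀ v₁ v₂ ≡ tripleColour v₂ v₃ v₄ →
    tripleColour v₀ v₁ v₂ ≢ tripleColour v₀ v₂ v₄ × tripleColour v₁ v₂ v₃ ≢ tripleColour v₀ v₂ v₄
  tripleColour-skip v₀<v₁ v₁<v₂ v₂<v₃ v₃<v₄
    rewrite firstDiff-⊓ (word-strictMono v₀<v₁) (word-strictMono v₁<v₂)
          | firstDiff-⊓ (word-strictMono v₂<v₃) (word-strictMono v₃<v₄) =
    pairColour-square (firstDiff-< (word-strictMono v₀<v₁)) (firstDiff-< (word-strictMono v₁<v₂))
      (firstDiff-≢ (word-strictMono v₀<v₁) (word-strictMono v₁<v₂))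

  colouring-is53 : Is53Coloring colouring
  colouring-is53 v₀ v₁ v₂ v₃ v₄ v₀<v₁ v₁<v₂ v₂<v₃ v₃<v₄ =
    atLeast3Distinct-of-four pairColour↣ Fin._≟_
      (∈-lookup (# 0)) (∈-lookup (# 6)) (∈-lookup (# 9)) (∈-lookup (# 4))
      (tripleColour-consecutive v₀<v₁ v₁<v₂ v₂<v₃) (tripleColour-consecutive v₁<v₂ v₂<v₃ v₃<v₄)
      (tripleColour-skip v₀<v₁ v₁<v₂ v₂<v₃ v₃<v₄)

mainTheorem1 : Σ ℕ λ C → Σ ℕ λ n₀ → (0 < C) × ((n s : ℕ) → n₀ ≤ n → n ≤ 2 ^ (2 ^ (s * s)) →
    Σ ℕ λ k → (k ≤ 2 ^ (C * s)) × Σ (Coloring3 n k) λ c → Is53Coloring c)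
mainTheorem1 = 4 , 3 , z<s , construction
  where
    construction : (n s : ℕ) → 3 ≤ n → n ≤ 2 ^ (2 ^ (s * s)) →
      Σ ℕ λ k → (k ≤ 2 ^ (4 * s)) × Σ (Coloring3 n k) Is53Coloring
    construction n zero 3≤n n≤2 = contradiction (≤-trans 3≤n n≤2) (n≮n 2)
    construction n s@(suc _) _ n≤2^2^[s*s] =
      2 ^ suc (s + (s + s)) , ^-monoʳ-≤ 2 bitLength≤4s ,
      TripleColouring.colouring s n n≤2^2^[s*s] , TripleColouring.colouring-is53 s n n≤2^2^[s*s]
      where
        open ≤-Reasoning
        bitLength≤4s : suc (s + (s + s)) ≤ 4 * s
        bitLength≤4s = begin
          1 + (s + (s + s))       ≤⟨ +-monoˡ-≤ (s + (s + s)) (s≤s z≤n) ⟩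
          s + (s + (s + s))       ≡⟨ cong (λ t → s + (s + (s + t))) (+-identityʳ s) ⟨
          4 * s                   ∎
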